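{- For every $\sigma\in S_n$, $\mathrm{exc}(\mathcal{K}(\sigma))=n-\mathrm{exc}(\sigma)-1=\mathrm{exc}(\mathcal{K}^{ -1}(\sigma))$.
   Context: Permutations are in one-line notation and composed right to left. Let $c=234\cdots n1\in S_n$ (i.e. $c(i)=i+1$ for $i<n$, $c(n)=1$). The Kreweras complement is $\mathcal{K}(\sigma)=c\circ\sigma^{ -1}$, with inverse $\mathcal{K}^{ -1}(\sigma)=\sigma^{ -1}\circ c$. $\mathrm{exc}(\sigma)=\#\{i:\sigma_i>i\}$ is the number of exceedances of $\sigma$. -}

module Defs where

open import Data.Nat using (ℕ; zero; suc)
open import Data.Fin using (Fin; zero; suc; _<?_)
open import Data.Fin.Permutation
  using (Permutation′; _⟨$⟩ʳ_; _∘ₚ_; flip; id; lift₀; transpose)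
open import Data.List using (length; filter; allFin)

-- Permutations of {1..n} are modelled 0-indexed as Permutation′ n (bijections Fin n ↔ Fin n);
-- σ ⟨$⟩ʳ i is σ(i). Note (π ∘ₚ ρ) applies π first, i.e. π ∘ₚ ρ = ρ ∘ π in usual notation.

-- The long cycle c on Fin (suc m): c(i) = i+1 for i < m, c(m) = 0
-- (0-indexed version of c = 23⋯n1 with n = suc m).
-- Built recursively: c_{m+1} = (0 1) ∘ lift₀ c_m.
cyc : (m : ℕ) → Permutation′ (suc m)
cyc zero    = id
cyc (suc m) = lift₀ (cyc m) ∘ₚ transpose zero (suc zero)

exc : {n : ℕ} → Permutation′ n → ℕ
exc {n} σ = length (filter (λ i → i <? (σ ⟨$⟩ʳ i)) (allFin n))

-- Kreweras complement K(σ) = c ∘ σ⁻¹ and its inverse K⁻¹(σ) = σ⁻¹ ∘ c.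
kreweras : {m : ℕ} → Permutation′ (suc m) → Permutation′ (suc m)
kreweras {m} σ = flip σ ∘ₚ cyc m

kreweras⁻¹ : {m : ℕ} → Permutation′ (suc m) → Permutation′ (suc m)
kreweras⁻¹ {m} σ = cyc m ∘ₚ flip σ

-- For any map f on Fin (1+m) and any i, the value f i lies either above i or below c i,
-- never both, except at the last point i = m, where c i = 0 and neither happens; so
-- #{i : i < f i} + #{i : f i < c i} = m.  Reindexing by σ turns #{i : σ i < c i} into exc (c ∘ σ⁻¹),
-- and reindexing by c and σ turns #{i : σ⁻¹ (c i) < c i} into exc σ.
module Submission where

open import Defs
open import Data.Nat using (ℕ; suc; _∸_)
open import Data.Product using (_×_)
open import Data.Fin.Permutation using (Permutation′)
open import Relation.Binary.PropositionalEquality using (_≡_)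

open import Data.Nat as ℕ using (zero; _+_; _<_; z≤n; s≤s)
open import Data.Nat.Properties as ℕ
  using (+-comm; m+n∸m≡n; ∸-+-assoc; <⇒≱; ≤-pred; ≮⇒≥)
open import Data.Fin as Fin using (Fin; toℕ; _<?_)
open import Data.Fin.Properties using (toℕ≤pred[n])
open import Data.Fin.Permutation using (_⟨$⟩ʳ_; _⟨$⟩ˡ_; flip; inverseʳ; inverseˡ)
open import Data.List using (length; filter; tabulate)
open import Data.Product using (_,_)
open import Data.Sum using (_⊎_; inj₁; inj₂)
open import Data.Empty using (⊥-elim)
open import Relation.Nullary using (Dec; yes; no)
open import Relation.Unary using (Pred; Decidable)
open import Relation.Binary.PropositionalEquality using (refl; sym; cong; cong₂; subst; module ≡-Reasoning)
open import Function using (_∘_)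
open import Algebra.Properties.CommutativeMonoid.Sum ℕ.+-0-commutativeMonoid
  using (sum; sum-syntax; ∑-distrib-+; sum-permute; sum-cong-≗)

private variable
  m n k : ℕ

indicator : ∀ {p} {A : Set p} → Dec A → ℕ
indicator (yes _) = 1
indicator (no _)  = 0

length-filter-tabulate : ∀ {p} {P : Pred (Fin n) p} (P? : Decidable P) (g : Fin k → Fin n) →
  length (filter P? (tabulate g)) ≡ ∑[ i < k ] indicator (P? (g i))
length-filter-tabulate {k = zero}  P? g = refl
length-filter-tabulate {k = suc k} P? g with P? (g Fin.zero)
... | yes _ = cong suc (length-filter-tabulate P? (g ∘ Fin.suc))
... | no _  = length-filter-tabulate P? (g ∘ Fin.suc)

exc≡∑ : (σ : Permutation′ n) → exc σ ≡ ∑[ i < n ] indicator (i <? σ ⟨$⟩ʳ i)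
exc≡∑ σ = length-filter-tabulate (λ i → i <? σ ⟨$⟩ʳ i) (λ i → i)

∑-reindex : (π : Permutation′ n) (f : Fin n → ℕ) → ∑[ i < n ] f (π ⟨$⟩ʳ i) ≡ sum f
∑-reindex π f = sym (sum-permute f π)

∑-const-1 : ∀ n → ∑[ i < n ] 1 ≡ n
∑-const-1 zero    = refl
∑-const-1 (suc n) = cong suc (∑-const-1 n)

cyc-last⊎cyc-suc : ∀ m (i : Fin (suc m)) →
  (toℕ i ≡ m × cyc m ⟨$⟩ʳ i ≡ Fin.zero) ⊎ toℕ (cyc m ⟨$⟩ʳ i) ≡ suc (toℕ i)
cyc-last⊎cyc-suc zero    Fin.zero    = inj₁ (refl , refl)
cyc-last⊎cyc-suc (suc m) Fin.zero    = inj₂ refl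
cyc-last⊎cyc-suc (suc m) (Fin.suc j) with cyc m ⟨$⟩ʳ j | cyc-last⊎cyc-suc m j
... | Fin.zero  | inj₁ (j≡m , _) = inj₁ (cong suc j≡m , refl)
... | Fin.suc _ | inj₂ cj≡1+j    = inj₂ (cong suc cj≡1+j)

ind[a<x]+ind[x<b]≡1 : (a x b : Fin n) → toℕ b ≡ suc (toℕ a) →
  indicator (a <? x) + indicator (x <? b) ≡ 1
ind[a<x]+ind[x<b]≡1 a x b b≡1+a with a <? x | x <? b
... | yes a<x | yes x<b = ⊥-elim (<⇒≱ a<x (≤-pred (subst (toℕ x <_) b≡1+a x<b)))
... | yes _   | no _    = refl
... | no _    | yes _   = refl
... | no a≮x  | no x≮b  = ⊥-elim (x≮b (subst (toℕ x <_) (sym b≡1+a) (s≤s (≮⇒≥ a≮x))))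

ind[i<x]+ind[x<ci]≡ind[0<ci] : ∀ m (i x : Fin (suc m)) →
  indicator (i <? x) + indicator (x <? cyc m ⟨$⟩ʳ i) ≡ indicator (Fin.zero {m} <? cyc m ⟨$⟩ʳ i)
ind[i<x]+ind[x<ci]≡ind[0<ci] m i x with cyc-last⊎cyc-suc m i
... | inj₁ (i≡m , ci≡0) rewrite ci≡0 with i <? x | x <? Fin.zero {m}
...   | yes i<x | _      = ⊥-elim (<⇒≱ i<x (subst (toℕ x ℕ.≤_) (sym i≡m) (toℕ≤pred[n] x)))
...   | no _    | yes ()
...   | no _    | no _   = refl
ind[i<x]+ind[x<ci]≡ind[0<ci] m i x | inj₂ ci≡1+i with Fin.zero {m} <? cyc m ⟨$⟩ʳ i
...   | yes _   = ind[a<x]+ind[x<b]≡1 i x (cyc m ⟨$⟩ʳ i) ci≡1+i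
...   | no 0≮ci = ⊥-elim (0≮ci (subst (0 <_) (sym ci≡1+i) (s≤s z≤n)))

∑-ind[0<ci]≡m : ∀ m → ∑[ i < suc m ] indicator (Fin.zero {m} <? cyc m ⟨$⟩ʳ i) ≡ m
∑-ind[0<ci]≡m m = begin
  ∑[ i < suc m ] indicator (Fin.zero {m} <? cyc m ⟨$⟩ʳ i)
    ≡⟨ ∑-reindex (cyc m) (λ j → indicator (Fin.zero {m} <? j)) ⟩
  ∑[ j < suc m ] indicator (Fin.zero {m} <? j)
    ≡⟨ sum-cong-≗ 0<suc ⟩
  ∑[ j < m ] 1
    ≡⟨ ∑-const-1 m ⟩
  m ∎
  where
  open ≡-Reasoning
  0<suc : (j : Fin m) → indicator (Fin.zero {m} <? Fin.suc j) ≡ 1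
  0<suc j with Fin.zero {m} <? Fin.suc j
  ... | yes _ = refl
  ... | no 0≮sj = ⊥-elim (0≮sj (s≤s z≤n))

∑-ind[i<fi]+∑-ind[fi<ci]≡m : ∀ m (f : Fin (suc m) → Fin (suc m)) →
  ∑[ i < suc m ] indicator (i <? f i) + ∑[ i < suc m ] indicator (f i <? cyc m ⟨$⟩ʳ i) ≡ m
∑-ind[i<fi]+∑-ind[fi<ci]≡m m f = begin
  ∑[ i < suc m ] indicator (i <? f i) + ∑[ i < suc m ] indicator (f i <? cyc m ⟨$⟩ʳ i)
    ≡⟨ sym (∑-distrib-+ (λ i → indicator (i <? f i)) (λ i → indicator (f i <? cyc m ⟨$⟩ʳ i))) ⟩
  ∑[ i < suc m ] (indicator (i <? f i) + indicator (f i <? cyc m ⟨$⟩ʳ i))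
    ≡⟨ sum-cong-≗ (λ i → ind[i<x]+ind[x<ci]≡ind[0<ci] m i (f i)) ⟩
  ∑[ i < suc m ] indicator (Fin.zero {m} <? cyc m ⟨$⟩ʳ i)
    ≡⟨ ∑-ind[0<ci]≡m m ⟩
  m ∎
  where open ≡-Reasoning

exc+exc-kreweras≡m : (σ : Permutation′ (suc m)) → exc σ + exc (kreweras σ) ≡ m
exc+exc-kreweras≡m {m} σ = begin
  exc σ + exc (kreweras σ)
    ≡⟨ cong₂ _+_ (exc≡∑ σ) exc-kreweras≡∑ ⟩
  ∑[ i < suc m ] indicator (i <? σ ⟨$⟩ʳ i) + ∑[ i < suc m ] indicator (σ ⟨$⟩ʳ i <? c i)
    ≡⟨ ∑-ind[i<fi]+∑-ind[fi<ci]≡m m (σ ⟨$⟩ʳ_) ⟩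
  m ∎
  where
  open ≡-Reasoning
  c = cyc m ⟨$⟩ʳ_
  exc-kreweras≡∑ : exc (kreweras σ) ≡ ∑[ i < suc m ] indicator (σ ⟨$⟩ʳ i <? c i)
  exc-kreweras≡∑ = begin
    exc (kreweras σ)
      ≡⟨ exc≡∑ (kreweras σ) ⟩
    ∑[ j < suc m ] indicator (j <? c (σ ⟨$⟩ˡ j))
      ≡⟨ sym (∑-reindex σ (λ j → indicator (j <? c (σ ⟨$⟩ˡ j)))) ⟩
    ∑[ i < suc m ] indicator (σ ⟨$⟩ʳ i <? c (σ ⟨$⟩ˡ (σ ⟨$⟩ʳ i)))
      ≡⟨ sum-cong-≗ (λ i → cong (λ y → indicator (σ ⟨$⟩ʳ i <? c y)) (inverseˡ σ {i})) ⟩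
    ∑[ i < suc m ] indicator (σ ⟨$⟩ʳ i <? c i) ∎

exc+exc-kreweras⁻¹≡m : (σ : Permutation′ (suc m)) → exc σ + exc (kreweras⁻¹ σ) ≡ m
exc+exc-kreweras⁻¹≡m {m} σ = begin
  exc σ + exc (kreweras⁻¹ σ)
    ≡⟨ +-comm (exc σ) (exc (kreweras⁻¹ σ)) ⟩
  exc (kreweras⁻¹ σ) + exc σ
    ≡⟨ cong₂ _+_ (exc≡∑ (kreweras⁻¹ σ)) exc≡∑-below-cyc ⟩
  ∑[ i < suc m ] indicator (i <? f i) + ∑[ i < suc m ] indicator (f i <? c i)
    ≡⟨ ∑-ind[i<fi]+∑-ind[fi<ci]≡m m f ⟩
  m ∎
  where
  open ≡-Reasoning
  c = cyc m ⟨$⟩ʳ_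
  f = λ i → σ ⟨$⟩ˡ c i
  exc≡∑-below-cyc : exc σ ≡ ∑[ i < suc m ] indicator (f i <? c i)
  exc≡∑-below-cyc = begin
    exc σ
      ≡⟨ exc≡∑ σ ⟩
    ∑[ k < suc m ] indicator (k <? σ ⟨$⟩ʳ k)
      ≡⟨ sym (∑-reindex (flip σ) (λ k → indicator (k <? σ ⟨$⟩ʳ k))) ⟩
    ∑[ j < suc m ] indicator (σ ⟨$⟩ˡ j <? σ ⟨$⟩ʳ (σ ⟨$⟩ˡ j))
      ≡⟨ sum-cong-≗ (λ j → cong (λ y → indicator (σ ⟨$⟩ˡ j <? y)) (inverseʳ σ {j})) ⟩
    ∑[ j < suc m ] indicator (σ ⟨$⟩ˡ j <? j)
      ≡⟨ sym (∑-reindex (cyc m) (λ j → indicator (σ ⟨$⟩ˡ j <? j))) ⟩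
    ∑[ i < suc m ] indicator (f i <? c i) ∎

a+b≡m⇒b≡1+m∸a∸1 : ∀ {a b} → a + b ≡ m → b ≡ suc m ∸ a ∸ 1
a+b≡m⇒b≡1+m∸a∸1 {m} {a} {b} a+b≡m = begin
  b               ≡⟨ sym (m+n∸m≡n a b) ⟩
  a + b ∸ a       ≡⟨ cong (_∸ a) a+b≡m ⟩
  m ∸ a           ≡⟨ cong (suc m ∸_) (+-comm 1 a) ⟩
  suc m ∸ (a + 1) ≡⟨ sym (∸-+-assoc (suc m) a 1) ⟩
  suc m ∸ a ∸ 1   ∎
  where open ≡-Reasoning

lemma7p16 : (m : ℕ) (σ : Permutation′ (suc m)) →
    (exc (kreweras σ) ≡ suc m ∸ exc σ ∸ 1) × (suc m ∸ exc σ ∸ 1 ≡ exc (kreweras⁻¹ σ))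
lemma7p16 m σ =
  a+b≡m⇒b≡1+m∸a∸1 (exc+exc-kreweras≡m σ) , sym (a+b≡m⇒b≡1+m∸a∸1 (exc+exc-kreweras⁻¹≡m σ))
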